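{- Let $G=G([n],E)$ be a simple undirected graph with Laplacian matrix $L$, and let $I$ be the $n\times n$ identity matrix. Then $G$ is a comparability graph if and only if there exist $\alpha\in\mathbb{R}_{\ge0}$ and an acyclic orientation $O$ of $E$ such that $C_O$ is invariant under left-multiplication by $\alpha I+L$ (i.e. $(\alpha I+L)x\in C_O$ for all $x\in C_O$). Moreover, if $G$ is a comparability graph, the acyclic orientations $O$ satisfying this condition (for some $\alpha\ge0$) are precisely the transitive orientations of $G$, and for them one can take $\alpha=0$.
   Context: $L_{ii}=\deg i$, $L_{ij}=-1$ if $\{i,j\}\in E$, else $0$. An acyclic orientation $O$ orients every edge with no directed cycles; it is transitive if the comparability graph of its reachability partial order equals $G$. $C_O=\{x\in\mathbb{R}^{[n]}:x_i\le x_j\text{ for all }(i,j)\in O\}$, the closure of the region of the graphical arrangement $\{x:x_i=x_j\text{ for some }\{i,j\}\in E\}$ corresponding to $O$.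
   Formalization: The parameter α ranges over the nonnegative rationals and the vectors of the cone $C_O$ have rational coordinates, rather than lying in $\mathbb{R}_{\ge0}$ and $\mathbb{R}^{[n]}$. -}

module Defs where

open import Level using (0ℓ)
open import Data.Bool using (Bool; true; false; if_then_else_)
open import Data.Nat using (ℕ; zero; suc)
open import Data.Fin using (Fin; zero; suc; _≟_)
open import Data.Rational using (ℚ; 0ℚ; 1ℚ; _+_; _*_; -_; _≤_)
open import Data.Product using (Σ; _×_; _,_)
open import Data.Sum using (_⊎_)
open import Relation.Nullary using (¬_; yes; no)
open import Relation.Binary.PropositionalEquality using (_≡_; _≢_)
open import Relation.Binary.Structures using (IsStrictPartialOrder)
open import Relation.Binary.Construct.Closure.Transitive using (TransClosure)
open import Function.Bundles using (_⇔_)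

record SimpleGraph (n : ℕ) : Set where
  field
    adj    : Fin n → Fin n → Bool
    sym    : ∀ i j → adj i j ≡ adj j i
    irrefl : ∀ i → adj i i ≡ false
open SimpleGraph public

sumFin : (n : ℕ) → (Fin n → ℚ) → ℚ
sumFin zero    f = 0ℚ
sumFin (suc n) f = f zero + sumFin n (λ i → f (suc i))

deg : ∀ {n} → SimpleGraph n → Fin n → ℚ
deg {n} G i = sumFin n (λ j → if adj G i j then 1ℚ else 0ℚ)

laplacian : ∀ {n} → SimpleGraph n → Fin n → Fin n → ℚ
laplacian G i j with i ≟ j
... | yes _ = deg G i
... | no  _ = if adj G i j then - 1ℚ else 0ℚ

identity : ∀ {n} → Fin n → Fin n → ℚ
identity i j with i ≟ j
... | yes _ = 1ℚ
... | no  _ = 0ℚ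

shiftedLaplacian : ∀ {n} → SimpleGraph n → ℚ → Fin n → Fin n → ℚ
shiftedLaplacian G α i j = α * identity i j + laplacian G i j

mulVec : ∀ {n} → (Fin n → Fin n → ℚ) → (Fin n → ℚ) → Fin n → ℚ
mulVec {n} M x i = sumFin n (λ j → M i j * x j)

-- An orientation O of E: O i j means the edge {i,j} is oriented i → j.
-- Every edge gets exactly one direction, and only edges are oriented.
IsOrientation : ∀ {n} → SimpleGraph n → (Fin n → Fin n → Set) → Set
IsOrientation G O =
  (∀ i j → O i j → adj G i j ≡ true) ×
  (∀ i j → adj G i j ≡ true → O i j ⊎ O j i) ×
  (∀ i j → O i j → ¬ O j i)

Reach : ∀ {n} → (Fin n → Fin n → Set) → Fin n → Fin n → Set
Reach O = TransClosure O

IsAcyclicOrientation : ∀ {n} → SimpleGraph n → (Fin n → Fin n → Set) → Set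
IsAcyclicOrientation G O = IsOrientation G O × (∀ i → ¬ Reach O i i)

IsTransitiveOrientation : ∀ {n} → SimpleGraph n → (Fin n → Fin n → Set) → Set
IsTransitiveOrientation G O =
  IsAcyclicOrientation G O ×
  (∀ i j → (adj G i j ≡ true) ⇔ (i ≢ j × (Reach O i j ⊎ Reach O j i)))

IsComparabilityGraph : ∀ {n} → SimpleGraph n → Set₁
IsComparabilityGraph {n} G =
  Σ (Fin n → Fin n → Set) λ R →
    IsStrictPartialOrder _≡_ R ×
    (∀ i j → (adj G i j ≡ true) ⇔ (i ≢ j × (R i j ⊎ R j i)))

InCone : ∀ {n} → (Fin n → Fin n → Set) → (Fin n → ℚ) → Set
InCone O x = ∀ i j → O i j → x i ≤ x j

IsInvariant : ∀ {n} → SimpleGraph n → ℚ → (Fin n → Fin n → Set) → Set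
IsInvariant G α O = ∀ x → InCone O x → InCone O (mulVec (shiftedLaplacian G α) x)

{-# OPTIONS --safe #-}
module Submission where

-- Write ((αI + L) x)_i as α x_i + Σ_{k ∼ i} (x_i − x_k).  For an arc i → j of a transitive
-- orientation, a neighbour k of i that is not a neighbour of j must satisfy i → k (k → i would
-- give k → j), and symmetrically; so on C_O every summand grows from i to j.
-- Conversely, let C_O be invariant and a → b → c with a ≁ c.  On the indicator x of the up-set U
-- of c we have x_a = x_b = 0, and invariance forces a to have at least as many neighbours in U as
-- b.  As c is a neighbour of b but not of a, some k ∈ U is adjacent to a but not to b, and walking
-- from c up to k produces a new such configuration b → p → q.  The middle vertex thus climbs
-- strictly in the acyclic order on a finite set, which cannot go on forever.

open import Defs
open import Data.Nat using (ℕ)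
open import Data.Fin using (Fin)
open import Data.Rational using (ℚ; 0ℚ; _≤_)
open import Data.Product using (Σ; _×_)
open import Function.Bundles using (_⇔_)

open import Algebra.Bundles using (CommutativeMonoid)
open import Data.Bool using (true; false; if_then_else_)
import Data.Bool as Bool
open import Data.Bool.Properties using (not-¬)
open import Data.Empty using (⊥-elim)
open import Data.Fin using (zero; suc; _≟_)
open import Data.Fin.Induction using (spo-noetherian)
open import Data.Fin.Properties using (suc-injective; any?)
open import Data.Nat using (zero; suc)
open import Data.Product using (_,_; proj₁; proj₂; ∃₂)
open import Data.Rational using (1ℚ; _+_; _*_; -_; _-_; _<_; nonNegative)
import Data.Rational.Properties as ℚ
open import Data.Rational.Solver using (module +-*-Solver)
open import Data.Sum using (_⊎_; inj₁; inj₂; [_,_]′)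
import Data.Sum as Sum
open import Function using (id; _∘_; flip)
open import Function.Bundles using (mk⇔; Equivalence)
open import Induction.WellFounded using (WellFounded; Acc; acc)
open import Relation.Binary.Construct.Closure.ReflexiveTransitive using (Star; ε; _◅_; _◅◅_)
open import Relation.Binary.Construct.Closure.Transitive using ([_]; _∷_; _++_; transitive⁻)
open import Relation.Binary.Definitions using (Transitive; Decidable)
open import Relation.Binary.PropositionalEquality using (_≡_; _≢_; refl; cong; cong₂; module ≡-Reasoning)
import Relation.Binary.PropositionalEquality as ≡
open import Relation.Binary.Structures using (IsStrictPartialOrder)
open import Relation.Nullary using (¬_; Dec; yes; no; contradiction)
open import Relation.Nullary.Decidable using (map′; _×-dec_)

open import Algebra.Properties.CommutativeSemigroup (CommutativeMonoid.commutativeSemigroup ℚ.+-0-commutativeMonoid)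
  using () renaming (interchange to +-interchange)
open import Algebra.Properties.Group ℚ.+-0-group using () renaming (∙-cancelʳ to +-cancelʳ)

sumFin-cong : ∀ n {f g : Fin n → ℚ} → (∀ k → f k ≡ g k) → sumFin n f ≡ sumFin n g
sumFin-cong zero    f≡g = refl
sumFin-cong (suc n) f≡g = cong₂ _+_ (f≡g zero) (sumFin-cong n (λ k → f≡g (suc k)))

sumFin-zero : ∀ n {f : Fin n → ℚ} → (∀ k → f k ≡ 0ℚ) → sumFin n f ≡ 0ℚ
sumFin-zero zero    f≡0 = refl
sumFin-zero (suc n) f≡0 = cong₂ _+_ (f≡0 zero) (sumFin-zero n (λ k → f≡0 (suc k)))

sumFin-δ : ∀ n {f : Fin n → ℚ} i → (∀ k → k ≢ i → f k ≡ 0ℚ) → sumFin n f ≡ f i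
sumFin-δ (suc n) {f} zero    f≡0 = begin
  f zero + sumFin n (λ k → f (suc k)) ≡⟨ cong (f zero +_) (sumFin-zero n (λ k → f≡0 (suc k) λ ())) ⟩
  f zero + 0ℚ                        ≡⟨ ℚ.+-identityʳ (f zero) ⟩
  f zero                             ∎
  where open ≡-Reasoning
sumFin-δ (suc n) {f} (suc i) f≡0 = begin
  f zero + sumFin n (λ k → f (suc k)) ≡⟨ cong₂ _+_ (f≡0 zero λ ()) (sumFin-δ n i λ k k≢i → f≡0 (suc k) (k≢i ∘ suc-injective)) ⟩
  0ℚ + f (suc i)                      ≡⟨ ℚ.+-identityˡ (f (suc i)) ⟩
  f (suc i)                           ∎
  where open ≡-Reasoning

sumFin-identity : ∀ n (i : Fin n) c → sumFin n (λ k → identity i k * c) ≡ c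
sumFin-identity n i c = ≡.trans (sumFin-δ n i offDiagonal) diagonal
  where
  offDiagonal : ∀ k → k ≢ i → identity i k * c ≡ 0ℚ
  offDiagonal k k≢i with i ≟ k
  ... | yes i≡k = contradiction (≡.sym i≡k) k≢i
  ... | no _    = ℚ.*-zeroˡ c
  diagonal : identity i i * c ≡ c
  diagonal with i ≟ i
  ... | yes _   = ℚ.*-identityˡ c
  ... | no i≢i  = contradiction refl i≢i

sumFin-+ : ∀ n (f g : Fin n → ℚ) → sumFin n (λ i → f i + g i) ≡ sumFin n f + sumFin n g
sumFin-+ zero    f g = refl
sumFin-+ (suc n) f g = begin
  (f zero + g zero) + sumFin n (λ i → f (suc i) + g (suc i))
    ≡⟨ cong ((f zero + g zero) +_) (sumFin-+ n (λ i → f (suc i)) (λ i → g (suc i))) ⟩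
  (f zero + g zero) + (sumFin n (λ i → f (suc i)) + sumFin n (λ i → g (suc i)))
    ≡⟨ +-interchange (f zero) (g zero) _ _ ⟩
  (f zero + sumFin n (λ i → f (suc i))) + (g zero + sumFin n (λ i → g (suc i))) ∎
  where open ≡-Reasoning

sumFin-*ʳ : ∀ n (f : Fin n → ℚ) c → sumFin n (λ i → f i * c) ≡ sumFin n f * c
sumFin-*ʳ zero    f c = ≡.sym (ℚ.*-zeroˡ c)
sumFin-*ʳ (suc n) f c = begin
  f zero * c + sumFin n (λ i → f (suc i) * c) ≡⟨ cong (f zero * c +_) (sumFin-*ʳ n (λ i → f (suc i)) c) ⟩
  f zero * c + sumFin n (λ i → f (suc i)) * c ≡⟨ ℚ.*-distribʳ-+ c (f zero) _ ⟨
  (f zero + sumFin n (λ i → f (suc i))) * c   ∎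
  where open ≡-Reasoning

sumFin-mono-≤ : ∀ n {f g : Fin n → ℚ} → (∀ i → f i ≤ g i) → sumFin n f ≤ sumFin n g
sumFin-mono-≤ zero    f≤g = ℚ.≤-refl
sumFin-mono-≤ (suc n) f≤g = ℚ.+-mono-≤ (f≤g zero) (sumFin-mono-≤ n (λ i → f≤g (suc i)))

sumFin-mono-< : ∀ n {f g : Fin n → ℚ} → (∀ i → f i ≤ g i) → ∀ j → f j < g j → sumFin n f < sumFin n g
sumFin-mono-< (suc n) f≤g zero    fj<gj = ℚ.+-mono-<-≤ fj<gj (sumFin-mono-≤ n (λ i → f≤g (suc i)))
sumFin-mono-< (suc n) f≤g (suc j) fj<gj = ℚ.+-mono-≤-< (f≤g zero) (sumFin-mono-< n (λ i → f≤g (suc i)) j fj<gj)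

p≤q⇒p-q≤0 : ∀ {p q} → p ≤ q → p - q ≤ 0ℚ
p≤q⇒p-q≤0 {p} {q} p≤q = ℚ.≤-trans (ℚ.+-monoˡ-≤ (- q) p≤q) (ℚ.≤-reflexive (ℚ.+-inverseʳ q))

p≤q⇒0≤q-p : ∀ {p q} → p ≤ q → 0ℚ ≤ q - p
p≤q⇒0≤q-p {p} {q} p≤q = ℚ.≤-trans (ℚ.≤-reflexive (≡.sym (ℚ.+-inverseʳ p))) (ℚ.+-monoˡ-≤ (- p) p≤q)

p<q⇒p-q<0 : ∀ {p q} → p < q → p - q < 0ℚ
p<q⇒p-q<0 {p} {q} p<q = ℚ.<-≤-trans (ℚ.+-monoˡ-< (- q) p<q) (ℚ.≤-reflexive (ℚ.+-inverseʳ q))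

indicator : ∀ {P : Set} → Dec P → ℚ
indicator (yes _) = 1ℚ
indicator (no _)  = 0ℚ

indicator-mono : ∀ {P Q : Set} (p? : Dec P) (q? : Dec Q) → (P → Q) → indicator p? ≤ indicator q?
indicator-mono (yes _) (yes _) _   = ℚ.≤-refl
indicator-mono (yes p) (no ¬q) P⇒Q = contradiction (P⇒Q p) ¬q
indicator-mono (no _)  (yes _) _   = ℚ.<⇒≤ (ℚ.positive⁻¹ 1ℚ)
indicator-mono (no _)  (no _)  _   = ℚ.≤-refl

indicator-< : ∀ {P Q : Set} (p? : Dec P) (q? : Dec Q) → ¬ P → Q → indicator p? < indicator q?
indicator-< (yes p) _       ¬p _ = contradiction p ¬p
indicator-< (no _)  (yes _) _  _ = ℚ.positive⁻¹ 1ℚ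
indicator-< (no _)  (no ¬q) _  q = contradiction q ¬q

edgeDifference : ∀ {n} → SimpleGraph n → (Fin n → ℚ) → Fin n → Fin n → ℚ
edgeDifference G x i k = if adj G i k then x i - x k else 0ℚ

module _ {n : ℕ} (G : SimpleGraph n) (α : ℚ) (x : Fin n → ℚ) (i : Fin n) where
  open +-*-Solver

  private
    adjacency : Fin n → ℚ
    adjacency k = if adj G i k then 1ℚ else 0ℚ

  -- deg i * x i is split over k and added on both sides, so that no subtraction occurs.
  shiftedLaplacian-term : ∀ k → shiftedLaplacian G α i k * x k + adjacency k * x i
                              ≡ edgeDifference G x i k + identity i k * ((α + deg G i) * x i)
  shiftedLaplacian-term k with i ≟ k
  ... | yes refl rewrite irrefl G i =
    solve 3 (λ a d y → (a :* con 1ℚ :+ d) :* y :+ con 0ℚ :* y := con 0ℚ :+ con 1ℚ :* ((a :+ d) :* y))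
      refl α (deg G i) (x i)
  ... | no _ with adj G i k
  ...   | true = solve 4 (λ a d y z → (a :* con 0ℚ :+ :- con 1ℚ) :* z :+ con 1ℚ :* y := (y :- z) :+ con 0ℚ :* ((a :+ d) :* y))
      refl α (deg G i) (x i) (x k)
  ...   | false = solve 4 (λ a d y z → (a :* con 0ℚ :+ con 0ℚ) :* z :+ con 0ℚ :* y := con 0ℚ :+ con 0ℚ :* ((a :+ d) :* y))
      refl α (deg G i) (x i) (x k)

  mulVec-shiftedLaplacian : mulVec (shiftedLaplacian G α) x i ≡ α * x i + sumFin n (edgeDifference G x i)
  mulVec-shiftedLaplacian = +-cancelʳ (deg G i * x i) _ _ (begin
    mulVec (shiftedLaplacian G α) x i + deg G i * x i
      ≡⟨ cong (mulVec (shiftedLaplacian G α) x i +_) (sumFin-*ʳ n adjacency (x i)) ⟨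
    mulVec (shiftedLaplacian G α) x i + sumFin n (λ k → adjacency k * x i)
      ≡⟨ sumFin-+ n _ _ ⟨
    sumFin n (λ k → shiftedLaplacian G α i k * x k + adjacency k * x i)
      ≡⟨ sumFin-cong n shiftedLaplacian-term ⟩
    sumFin n (λ k → edgeDifference G x i k + identity i k * ((α + deg G i) * x i))
      ≡⟨ sumFin-+ n _ _ ⟩
    S + sumFin n (λ k → identity i k * ((α + deg G i) * x i))
      ≡⟨ cong (S +_) (sumFin-identity n i _) ⟩
    S + (α + deg G i) * x i
      ≡⟨ solve 4 (λ s a d y → s :+ (a :+ d) :* y := (a :* y :+ s) :+ d :* y) refl S α (deg G i) (x i) ⟩
    (α * x i + S) + deg G i * x i ∎)
    where
    open ≡-Reasoning
    S : ℚ
    S = sumFin n (edgeDifference G x i)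

module _ {n : ℕ} (G : SimpleGraph n) (α : ℚ) (x : Fin n → ℚ) where

  mulVec-shiftedLaplacian-< : ∀ {a b c} → x a ≡ x b →
    (∀ k → adj G a k ≡ true → adj G b k ≡ false → x k ≤ x a) →
    (∀ k → adj G a k ≡ false → adj G b k ≡ true → x a ≤ x k) →
    adj G a c ≡ false → adj G b c ≡ true → x a < x c →
    mulVec (shiftedLaplacian G α) x b < mulVec (shiftedLaplacian G α) x a
  mulVec-shiftedLaplacian-< {a} {b} {c} xa≡xb a-only b-only a≁c b∼c xa<xc = begin-strict
    mulVec (shiftedLaplacian G α) x b        ≡⟨ mulVec-shiftedLaplacian G α x b ⟩
    α * x b + sumFin n (edgeDifference G x b) <⟨ ℚ.+-monoʳ-< (α * x b) (sumFin-mono-< n termwise c atC) ⟩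
    α * x b + sumFin n (edgeDifference G x a) ≡⟨ cong (λ t → α * t + sumFin n (edgeDifference G x a)) xa≡xb ⟨
    α * x a + sumFin n (edgeDifference G x a) ≡⟨ mulVec-shiftedLaplacian G α x a ⟨
    mulVec (shiftedLaplacian G α) x a        ∎
    where
    open ℚ.≤-Reasoning
    termwise : ∀ k → edgeDifference G x b k ≤ edgeDifference G x a k
    termwise k with adj G a k in ak | adj G b k in bk
    ... | true  | true  = ℚ.≤-reflexive (cong (_- x k) (≡.sym xa≡xb))
    ... | true  | false = p≤q⇒0≤q-p (a-only k ak bk)
    ... | false | true  = p≤q⇒p-q≤0 (≡.subst (_≤ x k) xa≡xb (b-only k ak bk))
    ... | false | false = ℚ.≤-refl
    atC : edgeDifference G x b c < edgeDifference G x a c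
    atC rewrite a≁c | b∼c = p<q⇒p-q<0 (≡.subst (_< x c) xa≡xb xa<xc)

module Orientation {n : ℕ} (G : SimpleGraph n) (O : Fin n → Fin n → Set)
                   (isOrientation : IsOrientation G O) where

  O⇒adj : ∀ {i j} → O i j → adj G i j ≡ true
  O⇒adj = proj₁ isOrientation _ _

  adj⇒O : ∀ {i j} → adj G i j ≡ true → O i j ⊎ O j i
  adj⇒O = proj₁ (proj₂ isOrientation) _ _

  O-asym : ∀ {i j} → O i j → ¬ O j i
  O-asym = proj₂ (proj₂ isOrientation) _ _

  O? : Decidable O
  O? i j with adj G i j in i∼j
  ... | true  = [ yes , no ∘ O-asym ]′ (adj⇒O i∼j)
  ... | false = no λ o → not-¬ i∼j (O⇒adj o)

  transitive⇒invariant : Transitive O → ∀ {α} → 0ℚ ≤ α → IsInvariant G α O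
  transitive⇒invariant O-trans {α} 0≤α x x∈C i j o = begin
    mulVec (shiftedLaplacian G α) x i         ≡⟨ mulVec-shiftedLaplacian G α x i ⟩
    α * x i + sumFin n (edgeDifference G x i) ≤⟨ ℚ.+-mono-≤ (ℚ.*-monoˡ-≤-nonNeg α {{nonNegative 0≤α}} (x∈C i j o))
                                                            (sumFin-mono-≤ n termwise) ⟩
    α * x j + sumFin n (edgeDifference G x j) ≡⟨ mulVec-shiftedLaplacian G α x j ⟨
    mulVec (shiftedLaplacian G α) x j         ∎
    where
    open ℚ.≤-Reasoning
    termwise : ∀ k → edgeDifference G x i k ≤ edgeDifference G x j k
    termwise k with adj G i k in i∼k | adj G j k in j∼k
    ... | true  | true  = ℚ.+-monoˡ-≤ (- x k) (x∈C i j o)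
    ... | true  | false = [ (λ ik → p≤q⇒p-q≤0 (x∈C i k ik))
                          , (λ ki → contradiction (≡.trans (sym G j k) (O⇒adj (O-trans ki o))) (not-¬ j∼k)) ]′ (adj⇒O i∼k)
    ... | false | true  = [ (λ jk → contradiction (O⇒adj (O-trans o jk)) (not-¬ i∼k))
                          , (λ kj → p≤q⇒0≤q-p (x∈C k j kj)) ]′ (adj⇒O j∼k)
    ... | false | false = ℚ.≤-refl

module AcyclicOrientation {n : ℕ} (G : SimpleGraph n) (O : Fin n → Fin n → Set)
                          (isAcyclicOrientation : IsAcyclicOrientation G O) where

  open Orientation G O (proj₁ isAcyclicOrientation) public

  acyclic : ∀ i → ¬ Reach O i i
  acyclic = proj₂ isAcyclicOrientation

  reach-isStrictPartialOrder : IsStrictPartialOrder _≡_ (Reach O)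
  reach-isStrictPartialOrder = record
    { isEquivalence = ≡.isEquivalence
    ; irrefl        = λ { refl → acyclic _ }
    ; trans         = _++_
    ; <-resp-≈      = (λ { refl r → r }) , (λ { refl r → r })
    }

  star-reach-trans : ∀ {i j k} → Star O i j → Reach O j k → Reach O i k
  star-reach-trans ε        jk = jk
  star-reach-trans (o ◅ ij) jk = o ∷ star-reach-trans ij jk

  reach-noetherian : WellFounded (flip (Reach O))
  reach-noetherian = spo-noetherian reach-isStrictPartialOrder

  star? : Decidable (Star O)
  star? c = go c (reach-noetherian c)
    where
    go : ∀ c → Acc (flip (Reach O)) c → ∀ k → Dec (Star O c k)
    go c (acc rec) k with c ≟ k
    ... | yes refl = yes ε
    ... | no c≢k   = map′ (λ (_ , cd , dk) → cd ◅ dk)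
                          (λ { ε → contradiction refl c≢k ; (cd ◅ dk) → _ , cd , dk })
                          (any? viaSuccessor)
      where
      viaSuccessor : ∀ d → Dec (O c d × Star O d k)
      viaSuccessor d with O? c d
      ... | yes cd = map′ (cd ,_) proj₂ (go d (rec [ cd ]) k)
      ... | no ¬cd = no (¬cd ∘ proj₁)

  Obstruction : Fin n → Fin n → Fin n → Set
  Obstruction a b c = O a b × O b c × adj G a c ≡ false

  no-obstruction⇒transitive : (∀ {a b c} → ¬ Obstruction a b c) → Transitive O
  no-obstruction⇒transitive obstruction-free {a} {b} {c} ab bc with adj G a c in a∼c
  ... | false = contradiction (ab , bc , a∼c) obstruction-free
  ... | true  = [ id , (λ ca → contradiction (ab ∷ bc ∷ [ ca ]) (acyclic a)) ]′ (adj⇒O a∼c)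

  isTransitiveOrientation⇔transitive : IsTransitiveOrientation G O ⇔ Transitive O
  isTransitiveOrientation⇔transitive = mk⇔ toTransitive fromTransitive
    where
    toTransitive : IsTransitiveOrientation G O → Transitive O
    toTransitive (_ , comparable) = no-obstruction⇒transitive λ (ab , bc , a≁c) →
      not-¬ a≁c (Equivalence.from (comparable _ _)
        ((λ { refl → acyclic _ (ab ∷ [ bc ]) }) , inj₁ (ab ∷ [ bc ])))
    fromTransitive : Transitive O → IsTransitiveOrientation G O
    fromTransitive O-trans = isAcyclicOrientation , λ i j → mk⇔ (comparable i j) (adjacent i j)
      where
      comparable : ∀ i j → adj G i j ≡ true → i ≢ j × (Reach O i j ⊎ Reach O j i)
      comparable i j i∼j = (λ { refl → not-¬ (irrefl G i) i∼j }) , Sum.map [_] [_] (adj⇒O i∼j)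
      adjacent : ∀ i j → i ≢ j × (Reach O i j ⊎ Reach O j i) → adj G i j ≡ true
      adjacent i j (_ , inj₁ ij) = O⇒adj (transitive⁻ O O-trans ij)
      adjacent i j (_ , inj₂ ji) = ≡.trans (sym G i j) (O⇒adj (transitive⁻ O O-trans ji))

  obstruction-along-path : ∀ {b p k} → O b p → Star O p k → adj G b k ≡ false →
                           ∃₂ λ q r → Obstruction b q r
  obstruction-along-path bp ε b≁k = contradiction (O⇒adj bp) (not-¬ b≁k)
  obstruction-along-path {b} bp (_◅_ {j = q} pq qk) b≁k with adj G b q in b∼q
  ... | false = _ , _ , bp , pq , b∼q
  ... | true with adj⇒O b∼q
  ...   | inj₁ bq = obstruction-along-path bq qk b≁k
  ...   | inj₂ qb = contradiction (bp ∷ pq ∷ [ qb ]) (acyclic b)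

  module _ (α : ℚ) (invariant : IsInvariant G α O) where

    obstruction-propagates : ∀ {a b c} → Obstruction a b c → ∃₂ λ q r → Obstruction b q r
    obstruction-propagates {a} {b} {c} (ab , bc , a≁c)
      with any? (λ k → star? c k ×-dec adj G a k Bool.≟ true ×-dec adj G b k Bool.≟ false)
    ... | yes (k , ck , _ , b≁k) = obstruction-along-path bc ck b≁k
    ... | no ∄k = ⊥-elim (ℚ.<-irrefl refl (ℚ.<-≤-trans
          (mulVec-shiftedLaplacian-< G α x xa≡xb a-only b-only a≁c (O⇒adj bc) xa<xc)
          (invariant x x∈C a b ab)))
      where
      x : Fin n → ℚ
      x k = indicator (star? c k)
      x∈C : InCone O x
      x∈C u v uv = indicator-mono (star? c u) (star? c v) (λ cu → cu ◅◅ uv ◅ ε)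
      below-c : ∀ {i} → Reach O i c → ¬ Star O c i
      below-c ic ci = acyclic _ (star-reach-trans ci ic)
      xa≡xb : x a ≡ x b
      xa≡xb = ℚ.≤-antisym (indicator-mono (star? c a) (star? c b) (⊥-elim ∘ below-c (ab ∷ [ bc ])))
                          (indicator-mono (star? c b) (star? c a) (⊥-elim ∘ below-c [ bc ]))
      a-only : ∀ k → adj G a k ≡ true → adj G b k ≡ false → x k ≤ x a
      a-only k a∼k b≁k = indicator-mono (star? c k) (star? c a) (λ ck → contradiction (k , ck , a∼k , b≁k) ∄k)
      b-only : ∀ k → adj G a k ≡ false → adj G b k ≡ true → x a ≤ x k
      b-only k _ _ = indicator-mono (star? c a) (star? c k) (⊥-elim ∘ below-c (ab ∷ [ bc ]))
      xa<xc : x a < x c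
      xa<xc = indicator-< (star? c a) (star? c c) (below-c (ab ∷ [ bc ])) ε

    no-obstruction : ∀ {a b c} → ¬ Obstruction a b c
    no-obstruction {b = b} = go b (reach-noetherian b)
      where
      go : ∀ b → Acc (flip (Reach O)) b → ∀ {a c} → ¬ Obstruction a b c
      go b (acc rec) obstruction with obstruction-propagates obstruction
      ... | q , r , next@(bq , _) = go q (rec [ bq ]) next

    invariant⇒transitiveOrientation : IsTransitiveOrientation G O
    invariant⇒transitiveOrientation =
      Equivalence.from isTransitiveOrientation⇔transitive (no-obstruction⇒transitive no-obstruction)

module _ {n : ℕ} (G : SimpleGraph n) where

  transitiveOrientation⇒invariant : ∀ O {α} → IsTransitiveOrientation G O → 0ℚ ≤ α → IsInvariant G α O
  transitiveOrientation⇒invariant O t@(isAcyclicOrientation , _) =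
    Orientation.transitive⇒invariant G O (proj₁ isAcyclicOrientation)
      (Equivalence.to (AcyclicOrientation.isTransitiveOrientation⇔transitive G O isAcyclicOrientation) t)

  comparability⇒transitiveOrientation : IsComparabilityGraph G → Σ (Fin n → Fin n → Set) (IsTransitiveOrientation G)
  comparability⇒transitiveOrientation (R , isSPO , comparable) =
    R , Equivalence.from (AcyclicOrientation.isTransitiveOrientation⇔transitive G R (isOrientation , acyclic)) R.trans
    where
    module R = IsStrictPartialOrder isSPO
    isOrientation : IsOrientation G R
    isOrientation = (λ i j r → Equivalence.from (comparable i j) ((λ i≡j → R.irrefl i≡j r) , inj₁ r))
                  , (λ i j i∼j → proj₂ (Equivalence.to (comparable i j) i∼j))
                  , (λ i j ij ji → R.irrefl refl (R.trans ij ji))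
    acyclic : ∀ i → ¬ Reach R i i
    acyclic i ii = R.irrefl refl (transitive⁻ R R.trans ii)

  transitiveOrientation⇒comparability : ∀ O → IsTransitiveOrientation G O → IsComparabilityGraph G
  transitiveOrientation⇒comparability O (isAcyclicOrientation , comparable) =
    Reach O , AcyclicOrientation.reach-isStrictPartialOrder G O isAcyclicOrientation , comparable

theorem4p1 : (n : ℕ) → (G : SimpleGraph n) →
    (IsComparabilityGraph G ⇔
      (Σ ℚ λ α → 0ℚ ≤ α × Σ (Fin n → Fin n → Set) λ O →
        IsAcyclicOrientation G O × IsInvariant G α O))
    ×
    (IsComparabilityGraph G →
      (∀ (O : Fin n → Fin n → Set) → IsAcyclicOrientation G O →
        ((Σ ℚ λ α → 0ℚ ≤ α × IsInvariant G α O) ⇔ IsTransitiveOrientation G O))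
      ×
      (∀ (O : Fin n → Fin n → Set) → IsTransitiveOrientation G O →
        IsInvariant G 0ℚ O))
theorem4p1 n G =
    mk⇔ (λ comparable →
           let (O , t) = comparability⇒transitiveOrientation G comparable
           in 0ℚ , ℚ.≤-refl , O , proj₁ t , invariantAtZero O t)
        (λ (α , _ , O , acyclic , invariant) →
           transitiveOrientation⇒comparability G O (invariant⇒transitiveOrientation G O acyclic α invariant))
  , λ _ → (λ O acyclic → mk⇔ (λ (α , _ , invariant) → invariant⇒transitiveOrientation G O acyclic α invariant)
                             (λ t → 0ℚ , ℚ.≤-refl , invariantAtZero O t))
        , invariantAtZero
  where
  open AcyclicOrientation using (invariant⇒transitiveOrientation)
  invariantAtZero : ∀ O → IsTransitiveOrientation G O → IsInvariant G 0ℚ O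
  invariantAtZero O t = transitiveOrientation⇒invariant G O t ℚ.≤-refl
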